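{- Let $S$ be a sorting sequence of length $p$ with $r>1$ distinct values and multiplicities $p_1,\dots,p_r$, and let $c=\gcd(p_1,\dots,p_r)$. Then there exist integers $\delta,\delta'$ (depending only on $S$) such that for every pile size $k\ge (4p-2p_1-2p_r)/c+2-r$ and every integer $f$ divisible by $c$ with $\delta<f<pk-\delta'$, the sorting strategy with outcome $S$ discreetly proves that there are $f$ fake coins.
   Context: There are $pk$ labelled coins arranged in $p$ piles of $k$ coins; each coin is real or fake, real coins all have one weight and fake coins all have one smaller weight. The sorting strategy sorts the piles by weight. A sorting sequence of length $p$ is a non-decreasing sequence of $p$ non-negative integers beginning with $0$ in which each entry equals the previous one or exceeds it by $1$; it records the outcome (piles listed heaviest to lightest; equal-weight piles get equal entries, a strictly lighter pile gets an entry one larger). If the distinct entries are $0,\dots,r-1$, let $p_i\ge1$ be the number of entries equal to $i-1$, so $p_1+\dots+p_r=p$; a configuration consistent with the outcome has the same number $f_i$ of fake coins in every pile marked $i-1$, with $0\le f_1<\dots<f_r\le k$. The strategy discreetly proves that there are $f$ fake coins if, given the outcome and the information that there are exactly $f$ fake coins, the status of no specific coin can be concluded: for every coin there is a configuration consistent with the outcome having exactly $f$ fake coins in which that coin is fake, and one in which that coin is real. -}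

module Defs where

open import Data.Nat using (ℕ; zero; suc; _+_; _*_; _∸_; _≤_; _<_)
open import Data.Nat.GCD using (gcd)
open import Data.Nat.Properties using (_≟_)
open import Data.Integer as ℤ using (ℤ; +_)
open import Data.Bool using (Bool; true; false)
open import Data.Fin using (Fin; zero; suc)
open import Data.List using (List; []; _∷_; length; filter; map; foldr; upTo; deduplicate; lookup)
open import Data.Product using (_×_; Σ; ∃)
open import Data.Sum using (_⊎_)
open import Data.Unit using (⊤)
open import Data.Empty using (⊥)
open import Relation.Binary.PropositionalEquality using (_≡_)

Steps : ℕ → List ℕ → Set
Steps a []       = ⊤
Steps a (b ∷ bs) = (b ≡ a ⊎ b ≡ suc a) × Steps b bs

IsSortingSeq : List ℕ → Set
IsSortingSeq []       = ⊥
IsSortingSeq (x ∷ xs) = (x ≡ 0) × Steps x xs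

numDistinct : List ℕ → ℕ
numDistinct S = length (deduplicate _≟_ S)

-- multiplicity of the value v in S  (p_i = mult S (i-1))
mult : List ℕ → ℕ → ℕ
mult S v = length (filter (_≟ v) S)

gcdMult : List ℕ → ℕ
gcdMult S = foldr gcd 0 (map (mult S) (upTo (numDistinct S)))

countFake : ∀ {k} → (Fin k → Bool) → ℕ
countFake {zero}  c = 0
countFake {suc k} c with c zero
... | true  = suc (countFake (λ i → c (suc i)))
... | false = countFake (λ i → c (suc i))

sumFin : ∀ {n} → (Fin n → ℕ) → ℕ
sumFin {zero}  g = 0
sumFin {suc n} g = g zero + sumFin (λ i → g (suc i))

-- A configuration of p piles of k coins: true = fake, false = real.
Config : ℕ → ℕ → Set
Config p k = Fin p → Fin k → Bool

totalFake : ∀ {p k} → Config p k → ℕ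
totalFake {p} {k} σ = sumFin (λ j → countFake (σ j))

-- σ is consistent with the sorting outcome S (piles listed in the order of S):
-- piles with equal entries weigh the same (same number of fakes), and a pile
-- with a larger entry is strictly lighter (strictly more fakes).
Consistent : (S : List ℕ) {k : ℕ} → Config (length S) k → Set
Consistent S σ =
  ∀ (j j' : Fin (length S)) →
    (lookup S j ≡ lookup S j' → countFake (σ j) ≡ countFake (σ j'))
    × (lookup S j < lookup S j' → countFake (σ j) < countFake (σ j'))

DiscreetlyProves : (S : List ℕ) (k : ℕ) (f : ℤ) → Set
DiscreetlyProves S k f =
  ∀ (j : Fin (length S)) (i : Fin k) →
    (Σ (Config (length S) k) λ σ → Consistent S σ × (+ totalFake σ ≡ f) × (σ j i ≡ true))
    × (Σ (Config (length S) k) λ σ → Consistent S σ × (+ totalFake σ ≡ f) × (σ j i ≡ false))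

-- By Bézout, the gcd c of the multiplicities is Σ_v (pos v − neg v) · p_v with bounded
-- coefficients. For f = (s + q p) c with 0 ≤ s < p, the pile counts
--   f_v = (q c − offset) + s · (pos v + bound − neg v) + p K v
-- sum to f, increase strictly with the mark v, and lie strictly between 0 and k as soon as f
-- is far enough from 0 and from p k; this fixes δ and δ'. A pile with 0 < f_v < k fakes can
-- be arranged so that any chosen coin is fake, or real, hence no coin's status is determined.
module Submission where

open import Defs
open import Data.Bool using (Bool; true; false; not; if_then_else_)
open import Data.Fin using (Fin; zero; suc; toℕ)
open import Data.Fin.Properties using (toℕ<n)
open import Data.Integer as ℤ using (ℤ)
import Data.Integer.Properties as ℤ
open import Data.Integer.Divisibility using (_∣_)
open import Data.List using (List; []; _∷_; length; map; foldr; lookup; upTo)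
open import Data.List.Properties using (map-id; map-cong)
open import Data.Nat using (ℕ; zero; suc; _+_; _*_; _∸_; _≤_; _<_; z≤n; s≤s; _≤?_; _≡ᵇ_; NonZero)
open import Data.Nat.DivMod using (_/_; _%_; m≡m%n+[m/n]*n; m%n<n)
open import Data.Nat.Divisibility using (divides) renaming (_∣_ to _∣ℕ_)
open import Data.Nat.GCD using (gcd; gcd-GCD; module Bézout)
open import Data.Nat.ListAction using (sum)
open import Data.Nat.Properties
open import Data.Nat.Tactic.RingSolver using (solve-∀)
open import Data.Product using (Σ; _×_; _,_; proj₁; proj₂)
open import Relation.Binary.PropositionalEquality
open import Relation.Binary.Definitions using (Monotonic₁)
open import Relation.Nullary using (yes; no)
open import Algebra.Properties.AbelianGroup ℤ.+-0-abelianGroup using (//-rightDividesˡ)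
open import Algebra.Properties.CommutativeSemigroup +-commutativeSemigroup using (interchange)

sum-map-+ : ∀ {A : Set} (f g : A → ℕ) xs →
  sum (map (λ x → f x + g x) xs) ≡ sum (map f xs) + sum (map g xs)
sum-map-+ f g []       = refl
sum-map-+ f g (x ∷ xs) = trans (cong (f x + g x +_) (sum-map-+ f g xs)) (interchange (f x) (g x) _ _)

sum-map-* : ∀ {A : Set} n (f : A → ℕ) xs → sum (map (λ x → n * f x) xs) ≡ n * sum (map f xs)
sum-map-* n f []       = sym (*-zeroʳ n)
sum-map-* n f (x ∷ xs) = trans (cong (n * f x +_) (sum-map-* n f xs)) (sym (*-distribˡ-+ n (f x) _))

sum-map-const : ∀ {A : Set} n (xs : List A) → sum (map (λ _ → n) xs) ≡ length xs * n
sum-map-const n []       = refl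
sum-map-const n (x ∷ xs) = cong (n +_) (sum-map-const n xs)

indicator : ℕ → ℕ → ℕ
indicator v x = if x ≡ᵇ v then 1 else 0

sum-map-indicator : ∀ v xs → sum (map (indicator v) xs) ≡ mult xs v
sum-map-indicator v []       = refl
sum-map-indicator v (x ∷ xs) with x ≡ᵇ v
... | true  = cong suc (sum-map-indicator v xs)
... | false = sum-map-indicator v xs

-- Coefficients are indexed by values but summed along the list, so the
-- coefficient of v is weighted by mult S v: d = Σ_v (pos v − neg v) · mult S v.
record BoundedCombination (S : List ℕ) (d : ℕ) : Set where
  field
    bound    : ℕ
    pos neg  : ℕ → ℕ
    pos≤     : ∀ x → pos x ≤ bound
    neg≤     : ∀ x → neg x ≤ bound
    balanced : d + sum (map neg S) ≡ sum (map pos S)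

module _ {S : List ℕ} where

  open BoundedCombination

  combination-zero : BoundedCombination S 0
  combination-zero = record
    { bound = 0 ; pos = λ _ → 0 ; neg = λ _ → 0
    ; pos≤ = λ _ → z≤n ; neg≤ = λ _ → z≤n ; balanced = refl }

  combination-mult : ∀ v → BoundedCombination S (mult S v)
  combination-mult v = record
    { bound = 1 ; pos = indicator v ; neg = λ _ → 0
    ; pos≤ = indicator≤1 ; neg≤ = λ _ → z≤n
    ; balanced = begin
        mult S v + sum (map (λ _ → 0) S) ≡⟨ cong (mult S v +_) (sum-map-const 0 S) ⟩
        mult S v + length S * 0          ≡⟨ cong (mult S v +_) (*-zeroʳ (length S)) ⟩
        mult S v + 0                     ≡⟨ +-identityʳ (mult S v) ⟩
        mult S v                         ≡⟨ sum-map-indicator v S ⟨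
        sum (map (indicator v) S)        ∎ }
    where
    open ≡-Reasoning
    indicator≤1 : ∀ x → indicator v x ≤ 1
    indicator≤1 x with x ≡ᵇ v
    ... | true  = ≤-refl
    ... | false = z≤n

  combination-* : ∀ n {d} → BoundedCombination S d → BoundedCombination S (n * d)
  combination-* n {d} C = record
    { bound = n * bound C ; pos = λ x → n * pos C x ; neg = λ x → n * neg C x
    ; pos≤ = λ x → *-monoʳ-≤ n (pos≤ C x) ; neg≤ = λ x → *-monoʳ-≤ n (neg≤ C x)
    ; balanced = begin
        n * d + sum (map (λ x → n * neg C x) S) ≡⟨ cong (n * d +_) (sum-map-* n (neg C) S) ⟩
        n * d + n * sum (map (neg C) S)         ≡⟨ *-distribˡ-+ n d _ ⟨
        n * (d + sum (map (neg C) S))           ≡⟨ cong (n *_) (balanced C) ⟩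
        n * sum (map (pos C) S)                 ≡⟨ sum-map-* n (pos C) S ⟨
        sum (map (λ x → n * pos C x) S)         ∎ }
    where open ≡-Reasoning

  -- d = (Σ pos₁ − Σ neg₁) − (Σ pos₂ − Σ neg₂): cross the coefficients.
  combination-cancel : ∀ {d e} → BoundedCombination S (d + e) → BoundedCombination S e →
    BoundedCombination S d
  combination-cancel {d} {e} C D = record
    { bound = bound C + bound D
    ; pos = λ x → pos C x + neg D x ; neg = λ x → neg C x + pos D x
    ; pos≤ = λ x → +-mono-≤ (pos≤ C x) (neg≤ D x)
    ; neg≤ = λ x → +-mono-≤ (neg≤ C x) (pos≤ D x)
    ; balanced = begin
        d + sum (map (λ x → neg C x + pos D x) S) ≡⟨ cong (d +_) (sum-map-+ (neg C) (pos D) S) ⟩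
        d + (Σneg₁ + sum (map (pos D) S))         ≡⟨ cong (λ t → d + (Σneg₁ + t)) (balanced D) ⟨
        d + (Σneg₁ + (e + Σneg₂))                 ≡⟨ regroup d Σneg₁ e Σneg₂ ⟩
        (d + e + Σneg₁) + Σneg₂                   ≡⟨ cong (_+ Σneg₂) (balanced C) ⟩
        sum (map (pos C) S) + Σneg₂               ≡⟨ sum-map-+ (pos C) (neg D) S ⟨
        sum (map (λ x → pos C x + neg D x) S)     ∎ }
    where
    open ≡-Reasoning
    Σneg₁ = sum (map (neg C) S)
    Σneg₂ = sum (map (neg D) S)
    regroup : ∀ a b c d → a + (b + (c + d)) ≡ (a + c + b) + d
    regroup = solve-∀

  combination-gcd : ∀ {a b} → BoundedCombination S a → BoundedCombination S b →
    BoundedCombination S (gcd a b)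
  combination-gcd {a} {b} A B with Bézout.identity (gcd-GCD a b)
  ... | Bézout.+- x y eq = combination-cancel (subst (BoundedCombination S) (sym eq) (combination-* x A)) (combination-* y B)
  ... | Bézout.-+ x y eq = combination-cancel (subst (BoundedCombination S) (sym eq) (combination-* y B)) (combination-* x A)

  combination-gcdMult : BoundedCombination S (gcdMult S)
  combination-gcdMult = go (upTo (numDistinct S))
    where
    go : ∀ vs → BoundedCombination S (foldr gcd 0 (map (mult S) vs))
    go []       = combination-zero
    go (v ∷ vs) = combination-gcd (combination-mult v) (go vs)

Pile : ℕ → Set
Pile k = Fin k → Bool

window : ℕ → ℕ → ℕ → Bool
window zero    zero    x       = false
window zero    (suc n) zero    = true
window zero    (suc n) (suc x) = window zero n x
window (suc a) n       zero    = false
window (suc a) n       (suc x) = window a n x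

countFake-window : ∀ k a n → a + n ≤ k → countFake {k} (λ x → window a n (toℕ x)) ≡ n
countFake-window zero    zero    zero    _           = refl
countFake-window (suc k) zero    zero    _           = countFake-window k zero zero z≤n
countFake-window (suc k) zero    (suc n) (s≤s a+n≤k) = cong suc (countFake-window k zero n a+n≤k)
countFake-window (suc k) (suc a) n       (s≤s a+n≤k) = countFake-window k a n a+n≤k

window-covers : ∀ a n x → a ≤ x → x < a + n → window a n x ≡ true
window-covers zero    (suc n) zero    _         _           = refl
window-covers zero    (suc n) (suc x) _         (s≤s x<n)   = window-covers zero n x z≤n x<n
window-covers (suc a) n       (suc x) (s≤s a≤x) (s≤s x<a+n) = window-covers a n x a≤x x<a+n

countFake-not : ∀ k (c : Pile k) → countFake (λ x → not (c x)) + countFake c ≡ k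
countFake-not zero    c = refl
countFake-not (suc k) c with c zero
... | true  = trans (+-suc _ _) (cong suc (countFake-not k (λ x → c (suc x))))
... | false = cong suc (countFake-not k (λ x → c (suc x)))

coveringWindow : ∀ {k n} x → 0 < n → n ≤ k → x < k → Σ ℕ λ a → a + n ≤ k × a ≤ x × x < a + n
coveringWindow {k} {n} x 0<n n≤k x<k with x + n ≤? k
... | yes x+n≤k = x , x+n≤k , ≤-refl , m<m+n x 0<n
... | no  x+n≰k = k ∸ n , ≤-reflexive (m∸n+n≡m n≤k) , k∸n≤x , subst (x <_) (sym (m∸n+n≡m n≤k)) x<k
  where
  k∸n≤x : k ∸ n ≤ x
  k∸n≤x = m≤n+o⇒m∸n≤o k n (≤-trans (<⇒≤ (≰⇒> x+n≰k)) (≤-reflexive (+-comm x n)))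

pileWithFake : ∀ {k n} (i : Fin k) → 0 < n → n ≤ k → Σ (Pile k) λ c → countFake c ≡ n × c i ≡ true
pileWithFake {k} {n} i 0<n n≤k with coveringWindow (toℕ i) 0<n n≤k (toℕ<n i)
... | a , a+n≤k , a≤i , i<a+n =
  (λ x → window a n (toℕ x)) , countFake-window k a n a+n≤k , window-covers a n (toℕ i) a≤i i<a+n

pileWithReal : ∀ {k n} (i : Fin k) → n < k → Σ (Pile k) λ c → countFake c ≡ n × c i ≡ false
pileWithReal {k} {n} i n<k with pileWithFake {n = k ∸ n} i (m<n⇒0<n∸m n<k) (m∸n≤m k n)
... | c , count , fake = (λ x → not (c x)) , count′ , cong not fake
  where
  count′ : countFake (λ x → not (c x)) ≡ n
  count′ = begin
    countFake (λ x → not (c x))                             ≡⟨ m+n∸n≡m _ (countFake c) ⟨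
    countFake (λ x → not (c x)) + countFake c ∸ countFake c ≡⟨ cong₂ _∸_ (countFake-not k c) count ⟩
    k ∸ (k ∸ n)                                             ≡⟨ m∸[m∸n]≡n (<⇒≤ n<k) ⟩
    n                                                       ∎
    where open ≡-Reasoning

sumFin-cong : ∀ {n} {g h : Fin n → ℕ} → (∀ j → g j ≡ h j) → sumFin g ≡ sumFin h
sumFin-cong {zero}  _   = refl
sumFin-cong {suc n} g≡h = cong₂ _+_ (g≡h zero) (sumFin-cong (λ j → g≡h (suc j)))

sumFin-lookup : ∀ {A : Set} (g : A → ℕ) xs → sumFin (λ j → g (lookup xs j)) ≡ sum (map g xs)
sumFin-lookup g []       = refl
sumFin-lookup g (x ∷ xs) = cong (g x +_) (sumFin-lookup g xs)

lookup≤sum : ∀ xs j → lookup xs j ≤ sum xs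
lookup≤sum (x ∷ xs) zero    = m≤m+n x (sum xs)
lookup≤sum (x ∷ xs) (suc j) = ≤-trans (lookup≤sum xs j) (m≤n+m (sum xs) x)

module _ (S : List ℕ) {k : ℕ} (F : ℕ → ℕ) (F-mono : Monotonic₁ _<_ _<_ F) where

  realises-profile : (σ : Config (length S) k) → (∀ j → countFake (σ j) ≡ F (lookup S j)) →
    Consistent S σ × totalFake σ ≡ sum (map F S)
  realises-profile σ count = consistent , trans (sumFin-cong count) (sumFin-lookup F S)
    where
    consistent : Consistent S σ
    consistent j j′ = (λ same → trans (count j) (trans (cong F same) (sym (count j′))))
                    , (λ lt → subst₂ _<_ (sym (count j)) (sym (count j′)) (F-mono lt))

  discreetlyProves-profile : (∀ j → 0 < F (lookup S j) × F (lookup S j) < k) →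
    DiscreetlyProves S k (ℤ.+ sum (map F S))
  discreetlyProves-profile bounds j i =
    fromPiles (λ j′ → pileWithFake i (proj₁ (bounds j′)) (<⇒≤ (proj₂ (bounds j′)))) ,
    fromPiles (λ j′ → pileWithReal i (proj₂ (bounds j′)))
    where
    fromPiles : ∀ {b} → (∀ j′ → Σ (Pile k) λ c → countFake c ≡ F (lookup S j′) × c i ≡ b) →
      Σ (Config (length S) k) λ σ → Consistent S σ × ℤ.+ totalFake σ ≡ ℤ.+ sum (map F S) × σ j i ≡ b
    fromPiles piles with realises-profile (λ j′ → proj₁ (piles j′)) (λ j′ → proj₁ (proj₂ (piles j′)))
    ... | consistent , total = (λ j′ → proj₁ (piles j′)) , consistent , cong ℤ.+_ total , proj₂ (proj₂ (piles j))

module Profile {S : List ℕ} {c : ℕ} (C : BoundedCombination S c) where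

  open BoundedCombination C

  p T K : ℕ
  p = length S
  T = sum S
  K = suc (bound + bound)

  spread : ℕ → ℕ
  spread v = pos v + (bound ∸ neg v)

  spread< : ∀ v → spread v < K
  spread< v = s≤s (+-mono-≤ (pos≤ v) (m∸n≤m bound (neg v)))

  sum-spread : sum (map spread S) ≡ c + p * bound
  sum-spread = begin
    sum (map spread S)                            ≡⟨ sum-map-+ pos (λ v → bound ∸ neg v) S ⟩
    sum (map pos S) + Σcomplement                 ≡⟨ cong (_+ Σcomplement) balanced ⟨
    c + sum (map neg S) + Σcomplement             ≡⟨ +-assoc c _ _ ⟩
    c + (sum (map neg S) + Σcomplement)           ≡⟨ cong (c +_) (+-comm _ Σcomplement) ⟩
    c + (Σcomplement + sum (map neg S))           ≡⟨ cong (c +_) (sum-map-+ (λ v → bound ∸ neg v) neg S) ⟨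
    c + sum (map (λ v → bound ∸ neg v + neg v) S) ≡⟨ cong (λ xs → c + sum xs) (map-cong (λ v → m∸n+n≡m (neg≤ v)) S) ⟩
    c + sum (map (λ _ → bound) S)                 ≡⟨ cong (c +_) (sum-map-const bound S) ⟩
    c + p * bound                                 ∎
    where
    open ≡-Reasoning
    Σcomplement = sum (map (λ v → bound ∸ neg v) S)

  lowerThreshold upperThreshold : ℕ
  lowerThreshold = p * bound + K * T
  upperThreshold = p * (bound + bound) + p * K * T

  module _ (q s : ℕ) (s<p : s < p) (large : lowerThreshold < q * c) where

    offset : ℕ
    offset = s * bound + K * T

    offset<qc : offset < q * c
    offset<qc = ≤-<-trans (+-monoˡ-≤ (K * T) (*-monoˡ-≤ bound (<⇒≤ s<p))) large

    -- Summed over S, s · spread contributes s c + s p·bound and p K v contributes p K T;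
    -- the offset removes the excess. Since s · spread v < p K, the slope p K wins.
    profile : ℕ → ℕ
    profile v = (q * c ∸ offset) + s * spread v + p * K * v

    profile-mono : Monotonic₁ _<_ _<_ profile
    profile-mono {v} {w} v<w = begin-strict
      profile v                                     ≡⟨ +-assoc (q * c ∸ offset) _ _ ⟩
      (q * c ∸ offset) + (s * spread v + p * K * v) <⟨ +-monoʳ-< (q * c ∸ offset) (+-monoˡ-< (p * K * v) s·spread<pK) ⟩
      (q * c ∸ offset) + (p * K + p * K * v)        ≡⟨ cong ((q * c ∸ offset) +_) (*-suc (p * K) v) ⟨
      (q * c ∸ offset) + p * K * suc v              ≤⟨ +-monoʳ-≤ (q * c ∸ offset) (*-monoʳ-≤ (p * K) v<w) ⟩
      (q * c ∸ offset) + p * K * w                  ≤⟨ +-monoˡ-≤ (p * K * w) (m≤m+n (q * c ∸ offset) (s * spread w)) ⟩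
      profile w                                     ∎
      where
      open ≤-Reasoning
      s·spread<pK : s * spread v < p * K
      s·spread<pK = *-mono-< s<p (spread< v)

    profile-positive : ∀ v → 0 < profile v
    profile-positive v = ≤-trans (m<n⇒0<n∸m offset<qc) (≤-trans (m≤m+n _ (s * spread v)) (m≤m+n _ (p * K * v)))

    profile-bounded : ∀ v → v ≤ T → profile v ≤ q * c + upperThreshold
    profile-bounded v v≤T = begin
      (q * c ∸ offset) + s * spread v + p * K * v
        ≤⟨ +-mono-≤ (+-mono-≤ (m∸n≤m (q * c) offset) (*-mono-≤ (<⇒≤ s<p) (≤-pred (spread< v)))) (*-monoʳ-≤ (p * K) v≤T) ⟩
      q * c + p * (bound + bound) + p * K * T ≡⟨ +-assoc (q * c) _ _ ⟩
      q * c + upperThreshold                  ∎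
      where open ≤-Reasoning

    sum-profile : sum (map profile S) ≡ (s + q * p) * c
    sum-profile = begin
      sum (map profile S)
        ≡⟨ sum-map-+ (λ v → (q * c ∸ offset) + s * spread v) (λ v → p * K * v) S ⟩
      sum (map (λ v → (q * c ∸ offset) + s * spread v) S) + sum (map (λ v → p * K * v) S)
        ≡⟨ cong₂ _+_ (sum-map-+ (λ _ → q * c ∸ offset) (λ v → s * spread v) S) (sum-map-* (p * K) (λ v → v) S) ⟩
      sum (map (λ _ → q * c ∸ offset) S) + sum (map (λ v → s * spread v) S) + p * K * sum (map (λ v → v) S)
        ≡⟨ cong₂ (λ a b → a + b + p * K * sum (map (λ v → v) S)) (sum-map-const (q * c ∸ offset) S) (sum-map-* s spread S) ⟩
      p * (q * c ∸ offset) + s * sum (map spread S) + p * K * sum (map (λ v → v) S)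
        ≡⟨ cong₂ (λ a b → p * (q * c ∸ offset) + s * a + p * K * b) sum-spread (cong sum (map-id S)) ⟩
      p * (q * c ∸ offset) + s * (c + p * bound) + p * K * T
        ≡⟨ regroup p (q * c ∸ offset) s c bound K T ⟩
      s * c + p * ((q * c ∸ offset) + offset)
        ≡⟨ cong (λ t → s * c + p * t) (m∸n+n≡m (<⇒≤ offset<qc)) ⟩
      s * c + p * (q * c)
        ≡⟨ regroup′ s c p q ⟩
      (s + q * p) * c ∎
      where
      open ≡-Reasoning
      regroup : ∀ p e s c b K T → p * e + s * (c + p * b) + p * K * T ≡ s * c + p * (e + (s * b + K * T))
      regroup = solve-∀
      regroup′ : ∀ s c p q → s * c + p * (q * c) ≡ (s + q * p) * c
      regroup′ = solve-∀

    discreetlyProves-multiple : ∀ {k} → q * c + upperThreshold < k →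
      DiscreetlyProves S k (ℤ.+ ((s + q * p) * c))
    discreetlyProves-multiple small = subst (λ n → DiscreetlyProves S _ (ℤ.+ n)) sum-profile
      (discreetlyProves-profile S profile profile-mono λ j →
        profile-positive (lookup S j) , ≤-<-trans (profile-bounded (lookup S j) (lookup≤sum S j)) small)

  discreetlyProves-range : ∀ {k n} .{{_ : NonZero p}} → c ∣ℕ n →
    p * (c + lowerThreshold) < n → n + p * upperThreshold < p * k →
    DiscreetlyProves S k (ℤ.+ n)
  discreetlyProves-range {k} {n} (divides m refl) lower< <upper =
    subst (λ m → DiscreetlyProves S k (ℤ.+ (m * c))) (sym m≡s+qp)
      (discreetlyProves-multiple q s s<p large small)
    where
    q s : ℕ
    q = m / p
    s = m % p
    s<p : s < p
    s<p = m%n<n m p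
    m≡s+qp : m ≡ s + q * p
    m≡s+qp = m≡m%n+[m/n]*n m p
    n≡ : n ≡ (s + q * p) * c
    n≡ = cong (_* c) m≡s+qp
    n≤p[c+qc] : (s + q * p) * c ≤ p * (c + q * c)
    n≤p[c+qc] = ≤-trans (*-monoˡ-≤ c (+-monoˡ-≤ (q * p) (<⇒≤ s<p))) (≤-reflexive (regroup p q c))
      where
      regroup : ∀ p q c → (p + q * p) * c ≡ p * (c + q * c)
      regroup = solve-∀
    large : lowerThreshold < q * c
    large = +-cancelˡ-< c _ _ (*-cancelˡ-< p _ _ (<-≤-trans lower< (≤-trans (≤-reflexive n≡) n≤p[c+qc])))
    p·qc≤n : p * (q * c) ≤ (s + q * p) * c
    p·qc≤n = ≤-trans (≤-reflexive (regroup p q c)) (*-monoˡ-≤ c (m≤n+m (q * p) s))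
      where
      regroup : ∀ p q c → p * (q * c) ≡ q * p * c
      regroup = solve-∀
    small : q * c + upperThreshold < k
    small = *-cancelˡ-< p _ _ (≤-<-trans (≤-reflexive (*-distribˡ-+ p (q * c) upperThreshold))
              (≤-<-trans (+-monoˡ-≤ (p * upperThreshold) (≤-trans p·qc≤n (≤-reflexive (sym n≡)))) <upper))

<-minus⇒+< : ∀ {i j k} → i ℤ.< j ℤ.- k → i ℤ.+ k ℤ.< j
<-minus⇒+< {i} {j} {k} i<j-k = subst (i ℤ.+ k ℤ.<_) (//-rightDividesˡ k j) (ℤ.+-monoˡ-< k i<j-k)

mainTheorem2 : (S : List ℕ) → IsSortingSeq S → 1 < numDistinct S →
    Σ ℤ λ δ → Σ ℤ λ δ' →
    ∀ (k : ℕ) →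
    (4 * length S ∸ 2 * mult S 0 ∸ 2 * mult S (numDistinct S ∸ 1)) + 2 * gcdMult S
    ≤ gcdMult S * (k + numDistinct S) →
    ∀ (f : ℤ) → (ℤ.+ gcdMult S) ∣ f →
    δ ℤ.< f → f ℤ.< (ℤ.+ (length S * k)) ℤ.- δ' →
    DiscreetlyProves S k f
mainTheorem2 S@(_ ∷ _) _ _ =
  ℤ.+ (p * (gcdMult S + lowerThreshold)) , ℤ.+ (p * upperThreshold) ,
  λ { k _ (ℤ.+ n) c∣n (ℤ.+<+ lower<) <upper →
        discreetlyProves-range c∣n lower< (ℤ.drop‿+<+ (<-minus⇒+< {k = ℤ.+ (p * upperThreshold)} <upper)) }
  where open Profile (combination-gcdMult {S})
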